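{- Let $d\ge 2$, $n\ge 1$, and let $w\in\mathcal A_d^n$ have period length $\ell_1$ for some positive integer $\ell_1<\frac n2$. Then for all $m\in\{1,\dots,d-1\}$, all $i,j,k\in\{1,\dots,n\}$ with $i\le k\le j$, and all positive integers $\ell_2\le\ell_1$ such that $j-i+1\ge\ell_1+\ell_2$ and either $k\ge i+\ell_1$ or $k\le j-\ell_1$, the string $w^{(k,m)}(i:j)$ does not have period length $\ell_2$.
   Context: $\mathcal A_d=\{0,1,\dots,d-1\}$; $\mathcal A_d^n$ is the set of strings $w=w_1\cdots w_n$ over $\mathcal A_d$; $u(i:j)=u_iu_{i+1}\cdots u_j$. For a position $k$ and $m\in\mathcal A_d$, $w^{(k,m)}$ is obtained from $w$ by replacing $w_k$ by $(w_k+m)\bmod d$ and keeping all other letters. A string $u$ of length $L$ has period length $\ell$ (a positive integer) if $L\ge 2\ell$ and $u_i=u_{i+\ell}$ for all $1\le i\le L-\ell$. -}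

module Defs where

open import Data.Nat using (ℕ; zero; suc; _+_; _∸_; _≤_; _<_; _*_; _≟_; _%_; s≤s; z≤n)
open import Data.Nat.Properties using (≤-trans)
open import Data.Nat.DivMod using (m%n<n)
open import Data.Fin using (Fin; toℕ; fromℕ<)
open import Data.Fin.Properties using (toℕ<n)
open import Data.Product using (_×_)
open import Relation.Nullary using (yes; no)
open import Relation.Binary.PropositionalEquality using (_≡_)

-- The alphabet A_d = {0,...,d-1} is Fin d; a string of length n is a
-- function Fin n → Fin d, where the Fin index t (0-based) holds w_{t+1}.
Word : ℕ → ℕ → Set
Word d n = Fin n → Fin d

HasPeriod : ∀ {d L} → Word d L → ℕ → Set
HasPeriod {d} {L} u ℓ =
  (1 ≤ ℓ) × (2 * ℓ ≤ L) ×
  ((t : ℕ) (p : t < L) (q : t + ℓ < L) → u (fromℕ< p) ≡ u (fromℕ< q))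

addMod : ∀ {d} → Fin d → ℕ → Fin d
addMod {suc d} a m = fromℕ< (m%n<n (toℕ a + m) (suc d))

-- w^{(k,m)}, k a 1-based position: letter w_k replaced by (w_k + m) mod d.
modify : ∀ {d n} → Word d n → ℕ → ℕ → Word d n
modify w k m t with suc (toℕ t) ≟ k
... | yes _ = addMod (w t) m
... | no _ = w t

substr-bound : ∀ i j n t → 1 ≤ i → t < suc j ∸ i → j ≤ n → (i ∸ 1) + t < n
substr-bound (suc zero) j n t _ p q = ≤-trans p q
substr-bound (suc (suc i)) zero n t _ () q
substr-bound (suc (suc i)) (suc j) (suc n) t _ p (s≤s q) =
  s≤s (substr-bound (suc i) j n t (s≤s z≤n) p q)

-- u(i:j) = u_i ... u_j for 1 ≤ i, j ≤ n (1-based), of length (j + 1) ∸ i.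
substr : ∀ {d n} → Word d n → (i j : ℕ) → 1 ≤ i → j ≤ n → Word d (suc j ∸ i)
substr {n = n} w i j 1≤i j≤n t = w (fromℕ< bound)
  where
  bound : (i ∸ 1) + toℕ t < n
  bound = substr-bound i j n (toℕ t) 1≤i (toℕ<n t) j≤n

module Submission where

-- A word w with period q = ℓ₁ < n is determined by the residue classes
-- mod q: w_y = cls (y mod q).  After changing the single letter at K, the
-- window u = w^{(K,m)}(i:j) is assumed to have period p = ℓ₂ ≤ q, with
-- |u| ≥ q + p.  Every pair (y, y+p) inside the window that avoids K then
-- shows cls y = cls (y+p).  A window of length q contains a representative
-- of every residue class, so this holds for all classes except possibly one
-- exceptional class e (e = K when K + q fits to the right of K, e = K - p
-- when K - q fits to the left).  Since y ↦ y + p permutes the classes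
-- mod q and the orbit of e + p returns to e, the equation also holds for e
-- ("closing the orbit").  Applied at e this forces the changed letter to
-- equal the original one, which is impossible as 0 < m < d.

open import Defs
open import Data.Nat using (ℕ; _+_; _∸_; _*_; _≤_; _<_; suc; zero; pred; s≤s; s≤s⁻¹; z≤n;
  _%_; _/_; _≟_; _<?_; NonZero; >-nonZero⁻¹)
open import Data.Nat.Properties
open import Data.Nat.DivMod using (m%n%n≡m%n; [m+n]%n≡m%n; [m+kn]%n≡m%n; m%n<n; m<n⇒m%n≡m;
  %-distribˡ-+; m≡m%n+[m/n]*n; m≤n⇒[n∸m]%m≡n%m)
open import Data.Fin using (Fin; toℕ; fromℕ<)
open import Data.Fin.Properties using (toℕ<n; toℕ-fromℕ<; fromℕ<-cong)
open import Data.Product using (_×_; _,_; ∃-syntax)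
open import Data.Sum using (_⊎_; inj₁; inj₂; [_,_])
open import Data.Empty using (⊥; ⊥-elim)
open import Relation.Nullary using (¬_; yes; no)
open import Relation.Binary.PropositionalEquality using (_≡_; _≢_; refl; sym; trans; cong; subst; ≢-sym; module ≡-Reasoning)

ResidueConstant : {A : Set} (q : ℕ) .{{_ : NonZero q}} → (ℕ → A) → Set
ResidueConstant q c = ∀ x y → x % q ≡ y % q → c x ≡ c y

+-pres-residue : ∀ q .{{_ : NonZero q}} p {x y} → x % q ≡ y % q → (x + p) % q ≡ (y + p) % q
+-pres-residue q p {x} {y} x≡y = begin
  (x + p) % q             ≡⟨ %-distribˡ-+ x p q ⟩
  (x % q + p % q) % q     ≡⟨ cong (λ r → (r + p % q) % q) x≡y ⟩
  (y % q + p % q) % q     ≡⟨ %-distribˡ-+ y p q ⟨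
  (y + p) % q             ∎
  where open ≡-Reasoning

representative : ∀ q .{{_ : NonZero q}} x a → ∃[ y ] y % q ≡ x % q × a ≤ y × y < a + q
representative q x zero = x % q , m%n%n≡m%n x q , z≤n , m%n<n x q
representative q x (suc a) with representative q x a
... | y , y≡x , a≤y , y<a+q with y ≟ a
...   | yes refl = y + q , trans ([m+n]%n≡m%n y q) y≡x , m<m+n y (>-nonZero⁻¹ q) , n<1+n (y + q)
...   | no y≢a = y , y≡x , ≤∧≢⇒< a≤y (≢-sym y≢a) , m≤n⇒m≤1+n y<a+q

-- If c is constant on residue classes mod q and
-- c x = c (x + p) for every x outside the class of e, then also
-- c e = c (e + p): following e + p, e + 2p, … the sequence stays constant
-- until it first re-enters the class of e, which it does by e + q·p.
module _ {A : Set} (q : ℕ) .{{_ : NonZero q}} (c : ℕ → A) (c-res : ResidueConstant q c)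
         (p e : ℕ) (step : ∀ x → x % q ≢ e % q → c x ≡ c (x + p)) where

  orbit : ∀ s → c e ≡ c (e + p) ⊎ c (e + p) ≡ c (e + suc s * p)
  orbit zero = inj₂ (cong (λ t → c (e + t)) (sym (+-identityʳ p)))
  orbit (suc s) with orbit s
  ... | inj₁ closed = inj₁ closed
  ... | inj₂ chain with (e + suc s * p) % q ≟ e % q
  ...   | yes back = inj₁ (sym (trans chain (c-res _ _ back)))
  ...   | no away = inj₂ (trans chain (trans (step _ away) (cong c next)))
    where
    next : e + suc s * p + p ≡ e + suc (suc s) * p
    next = trans (+-assoc e (suc s * p) p) (cong (e +_) (+-comm (suc s * p) p))

  close-orbit : c e ≡ c (e + p)
  close-orbit with orbit (pred q)
  ... | inj₁ closed = closed
  ... | inj₂ chain = sym (trans chain (c-res _ _ returns))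
    where
    returns : (e + suc (pred q) * p) % q ≡ e % q
    returns = begin
      (e + suc (pred q) * p) % q ≡⟨ cong (λ t → (e + t * p) % q) (suc-pred q) ⟩
      (e + q * p) % q            ≡⟨ cong (λ t → (e + t) % q) (*-comm q p) ⟩
      (e + p * q) % q            ≡⟨ [m+kn]%n≡m%n e p q ⟩
      e % q                      ∎
      where open ≡-Reasoning

update : {A : Set} → (ℕ → A) → ℕ → (A → A) → ℕ → A
update f K g y with y ≟ K
... | yes _ = g (f y)
... | no _ = f y

update-off : {A : Set} (f : ℕ → A) (K : ℕ) (g : A → A) (y : ℕ) → y ≢ K → update f K g y ≡ f y
update-off f K g y y≢K with y ≟ K
... | yes y≡K = ⊥-elim (y≢K y≡K)
... | no _ = refl

update-at : {A : Set} (f : ℕ → A) (K : ℕ) (g : A → A) → update f K g K ≡ g (f K)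
update-at f K g with K ≟ K
... | yes _ = refl
... | no K≢K = ⊥-elim (K≢K refl)

module OneLetterChange
  {A : Set} (q : ℕ) .{{_ : NonZero q}} (c : ℕ → A) (c-res : ResidueConstant q c)
  (u : ℕ → A) (K : ℕ) (agree : ∀ y → y ≢ K → u y ≡ c y) (changed : u K ≢ c K)
  (a j p : ℕ) (p>0 : 0 < p) (p≤q : p ≤ q) (room : a + (q + p) ≤ j)
  (u-per : ∀ y → a ≤ y → y + p < j → u y ≡ u (y + p)) where

  CleanPair : ℕ → Set
  CleanPair y = a ≤ y × y + p < j × y ≢ K × y + p ≢ K

  clean-step : ∀ {y} → CleanPair y → c y ≡ c (y + p)
  clean-step {y} (a≤y , y+p<j , y≢K , y+p≢K) = begin
    c y       ≡⟨ agree y y≢K ⟨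
    u y       ≡⟨ u-per y a≤y y+p<j ⟩
    u (y + p) ≡⟨ agree (y + p) y+p≢K ⟩
    c (y + p) ∎
    where open ≡-Reasoning

  exceptional-step : ∀ e → (∀ x → x % q ≢ e % q → ∃[ y ] y % q ≡ x % q × CleanPair y) →
                     c e ≡ c (e + p)
  exceptional-step e cover = close-orbit q c c-res p e step
    where
    step : ∀ x → x % q ≢ e % q → c x ≡ c (x + p)
    step x x≢e with cover x x≢e
    ... | y , y≡x , clean =
      trans (c-res x y (sym y≡x)) (trans (clean-step clean) (c-res _ _ (+-pres-residue q p y≡x)))

  in-window : ∀ {y} → y < a + q → y + p < j
  in-window y<a+q = <-≤-trans (+-monoˡ-< p y<a+q) (subst (_≤ j) (sym (+-assoc a q p)) room)

  apart : ∀ {x y e} → y % q ≡ x % q → x % q ≢ e % q → y ≢ e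
  apart y≡x x≢e y≡e = x≢e (trans (sym y≡x) (cong (_% q) y≡e))

  q>0 : 0 < q
  q>0 = <-≤-trans p>0 p≤q

  -- q window positions right of K: the exceptional class is that of K.
  change-right : a ≤ K → K + q < j → ⊥
  change-right a≤K K+q<j = changed (begin
    u K       ≡⟨ u-per K a≤K K+p<j ⟩
    u (K + p) ≡⟨ agree (K + p) (>⇒≢ (m<m+n K p>0)) ⟩
    c (K + p) ≡⟨ exceptional-step K cover ⟨
    c K       ∎)
    where
    open ≡-Reasoning
    K+p<j : K + p < j
    K+p<j = ≤-<-trans (+-monoʳ-≤ K p≤q) K+q<j
    cover : ∀ x → x % q ≢ K % q → ∃[ y ] y % q ≡ x % q × CleanPair y
    cover x x≢K with representative q x a
    ... | y , y≡x , a≤y , y<a+q with y + p ≟ K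
    ...   | no y+p≢K = y , y≡x , a≤y , in-window y<a+q , apart y≡x x≢K , y+p≢K
    ...   | yes y+p≡K = y + q , y+q≡x , ≤-trans a≤y (m≤m+n y q) , subst (_< j) (sym shifted) K+q<j ,
                        apart y+q≡x x≢K , (λ eq → >⇒≢ (m<m+n K q>0) (trans (sym shifted) eq))
      where
      y+q≡x : (y + q) % q ≡ x % q
      y+q≡x = trans ([m+n]%n≡m%n y q) y≡x
      shifted : y + q + p ≡ K + q
      shifted = begin
        y + q + p   ≡⟨ +-assoc y q p ⟩
        y + (q + p) ≡⟨ cong (y +_) (+-comm q p) ⟩
        y + (p + q) ≡⟨ +-assoc y p q ⟨
        y + p + q   ≡⟨ cong (_+ q) y+p≡K ⟩
        K + q       ∎

  -- q window positions left of K: the exceptional class is that of K - p.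
  change-left : a + q ≤ K → K < j → ⊥
  change-left a+q≤K K<j = changed (begin
    u K       ≡⟨ cong u e+p≡K ⟨
    u (e + p) ≡⟨ u-per e a≤e (subst (_< j) (sym e+p≡K) K<j) ⟨
    u e       ≡⟨ agree e (λ e≡K → >⇒≢ (m<m+n e p>0) (trans e+p≡K (sym e≡K))) ⟩
    c e       ≡⟨ exceptional-step e cover ⟩
    c (e + p) ≡⟨ cong c e+p≡K ⟩
    c K       ∎)
    where
    open ≡-Reasoning
    q≤K : q ≤ K
    q≤K = ≤-trans (m≤n+m q a) a+q≤K
    e : ℕ
    e = K ∸ p
    e+p≡K : e + p ≡ K
    e+p≡K = m∸n+n≡m (≤-trans p≤q q≤K)
    a≤e : a ≤ e
    a≤e = m+n≤o⇒m≤o∸n a (≤-trans (+-monoʳ-≤ a p≤q) a+q≤K)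
    -- a pair ending at K starts at e
    ends-at-K : ∀ {x y} → y % q ≡ x % q → x % q ≢ e % q → y + p ≢ K
    ends-at-K {y = y} y≡x x≢e y+p≡K = apart y≡x x≢e (+-cancelʳ-≡ p y e (trans y+p≡K (sym e+p≡K)))
    cover : ∀ x → x % q ≢ e % q → ∃[ y ] y % q ≡ x % q × CleanPair y
    cover x x≢e with representative q x a
    ... | y , y≡x , a≤y , y<a+q with y ≟ K
    ...   | no y≢K = y , y≡x , a≤y , in-window y<a+q , y≢K , ends-at-K y≡x x≢e
    ...   | yes refl = y ∸ q , back≡x , m+n≤o⇒m≤o∸n a a+q≤K , back+p<j , back≢y , ends-at-K back≡x x≢e
      where
      back≡x : (y ∸ q) % q ≡ x % q
      back≡x = trans (m≤n⇒[n∸m]%m≡n%m q≤K) y≡x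
      back+p<j : y ∸ q + p < j
      back+p<j = ≤-<-trans (≤-trans (+-monoʳ-≤ (y ∸ q) p≤q) (≤-reflexive (m∸n+n≡m q≤K))) K<j
      back≢y : y ∸ q ≢ y
      back≢y eq = >⇒≢ (m<m+n y q>0) (trans (cong (_+ q) (sym eq)) (m∸n+n≡m q≤K))

addMod-changes : ∀ {d} (b : Fin d) m → 0 < m → m < d → addMod b m ≢ b
addMod-changes {suc d} b m m>0 m<D same with toℕ b + m <? suc d
... | yes no-wrap = >⇒≢ (m<m+n (toℕ b) m>0) (trans (sym (m<n⇒m%n≡m no-wrap)) value)
  where
  value : (toℕ b + m) % suc d ≡ toℕ b
  value = trans (sym (toℕ-fromℕ< _)) (cong toℕ same)
... | no wrap = <⇒≢ m<D (+-cancelˡ-≡ (toℕ b) m (suc d) (trans (sym (m∸n+n≡m D≤b+m)) (cong (_+ suc d) r≡b)))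
  where
  open ≡-Reasoning
  D≤b+m : suc d ≤ toℕ b + m
  D≤b+m = ≮⇒≥ wrap
  b+m<2D : toℕ b + m < suc d + suc d
  b+m<2D = +-mono-< (toℕ<n b) m<D
  r<D : toℕ b + m ∸ suc d < suc d
  r<D = subst (toℕ b + m ∸ suc d <_) (m+n∸n≡m (suc d) (suc d)) (∸-monoˡ-< b+m<2D D≤b+m)
  r≡b : toℕ b + m ∸ suc d ≡ toℕ b
  r≡b = begin
    toℕ b + m ∸ suc d               ≡⟨ m<n⇒m%n≡m r<D ⟨
    (toℕ b + m ∸ suc d) % suc d     ≡⟨ m≤n⇒[n∸m]%m≡n%m D≤b+m ⟩
    (toℕ b + m) % suc d             ≡⟨ toℕ-fromℕ< _ ⟨
    toℕ (addMod b m)                ≡⟨ cong toℕ same ⟩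
    toℕ b                           ∎

module PeriodicWord {D n : ℕ} (w : Word D n) (q : ℕ) .{{_ : NonZero q}} (q<n : q < n)
  (w-per : (t : ℕ) (p : t < n) (r : t + q < n) → w (fromℕ< p) ≡ w (fromℕ< r)) where

  cls : ℕ → Fin D
  cls x = w (fromℕ< (<-trans (m%n<n x q) q<n))

  cls-residue : ResidueConstant q cls
  cls-residue x y x≡y = cong w (fromℕ<-cong _ _ x≡y _ _)

  shift : ∀ r s (h : r + s * q < n) (h′ : r < n) → w (fromℕ< h) ≡ w (fromℕ< h′)
  shift r zero h h′ = cong w (fromℕ<-cong _ _ (+-identityʳ r) h h′)
  shift r (suc s) h h′ =
    trans (cong w (fromℕ<-cong _ _ regroup h h₂)) (trans (sym (w-per t h₁ h₂)) (shift r s h₁ h′))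
    where
    t : ℕ
    t = r + s * q
    regroup : r + (q + s * q) ≡ t + q
    regroup = trans (cong (r +_) (+-comm q (s * q))) (sym (+-assoc r (s * q) q))
    h₂ : t + q < n
    h₂ = subst (_< n) regroup h
    h₁ : t < n
    h₁ = ≤-<-trans (m≤m+n t q) h₂

  letter≡cls : ∀ y (h : y < n) → w (fromℕ< h) ≡ cls y
  letter≡cls y h =
    trans (cong w (fromℕ<-cong _ _ (m≡m%n+[m/n]*n y q) h h′)) (shift (y % q) (y / q) h′ (<-trans (m%n<n y q) q<n))
    where
    h′ : y % q + y / q * q < n
    h′ = subst (_< n) (m≡m%n+[m/n]*n y q) h

  -- w^{(K+1,m)} as a sequence: cls with the term at K shifted by m.
  modified : ℕ → ℕ → ℕ → Fin D
  modified K m = update cls K (λ b → addMod b m)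

  modify-letter : ∀ K m y (h : y < n) → modify w (suc K) m (fromℕ< h) ≡ modified K m y
  modify-letter K m y h with suc (toℕ (fromℕ< h)) ≟ suc K | y ≟ K
  ... | yes _ | yes refl = cong (λ b → addMod b m) (letter≡cls y h)
  ... | no _ | no _ = letter≡cls y h
  ... | yes at | no y≢K = ⊥-elim (y≢K (trans (sym (toℕ-fromℕ< h)) (suc-injective at)))
  ... | no off | yes refl = ⊥-elim (off (cong suc (toℕ-fromℕ< h)))

  window-period : ∀ K m a j (j≤n : j ≤ n) p →
    HasPeriod (substr (modify w (suc K) m) (suc a) j (s≤s z≤n) j≤n) p →
    ∀ y → a ≤ y → y + p < j → modified K m y ≡ modified K m (y + p)
  window-period K m a j j≤n p (_ , _ , per) y a≤y y+p<j = begin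
    modified K m y                     ≡⟨ cong (modified K m) start ⟨
    modified K m (a + t)               ≡⟨ at-offset t t< ⟨
    substring (fromℕ< t<)              ≡⟨ per t t< t+p< ⟩
    substring (fromℕ< t+p<)            ≡⟨ at-offset (t + p) t+p< ⟩
    modified K m (a + (t + p))         ≡⟨ cong (modified K m) end ⟩
    modified K m (y + p)               ∎
    where
    open ≡-Reasoning
    substring : Word D (j ∸ a)
    substring = substr (modify w (suc K) m) (suc a) j (s≤s z≤n) j≤n
    at-offset : ∀ s (s< : s < j ∸ a) → substring (fromℕ< s<) ≡ modified K m (a + s)
    at-offset s s< =
      trans (cong (modify w (suc K) m) (fromℕ<-cong _ _ (cong (a +_) (toℕ-fromℕ< s<)) _ in-word))
            (modify-letter K m (a + s) in-word)
      where
      in-word : a + s < n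
      in-word = substr-bound (suc a) j n s (s≤s z≤n) s< j≤n
    t : ℕ
    t = y ∸ a
    start : a + t ≡ y
    start = m+[n∸m]≡n a≤y
    end : a + (t + p) ≡ y + p
    end = trans (sym (+-assoc a t p)) (cong (_+ p) start)
    t+p< : t + p < j ∸ a
    t+p< = subst (_< j ∸ a) (+-∸-comm p a≤y) (∸-monoˡ-< y+p<j (≤-trans a≤y (m≤m+n y p)))
    t< : t < j ∸ a
    t< = ≤-<-trans (m≤m+n t p) t+p<

-- With i = a + 1 and k = K + 1, the window is [a, j) and the changed
-- position is K; the two sides of the disjunction are change-left/right.
lemma2p16 : (d n : ℕ) → 2 ≤ d → 1 ≤ n → (w : Word d n) →
    (ℓ₁ : ℕ) → 1 ≤ ℓ₁ → 2 * ℓ₁ < n → HasPeriod w ℓ₁ →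
    (m : ℕ) → 1 ≤ m → m ≤ d ∸ 1 →
    (i j k : ℕ) → (1≤i : 1 ≤ i) → i ≤ n → 1 ≤ j → (j≤n : j ≤ n) → 1 ≤ k → k ≤ n →
    i ≤ k → k ≤ j →
    (ℓ₂ : ℕ) → 1 ≤ ℓ₂ → ℓ₂ ≤ ℓ₁ →
    ℓ₁ + ℓ₂ ≤ suc j ∸ i →
    (i + ℓ₁ ≤ k ⊎ k + ℓ₁ ≤ j) →
    ¬ HasPeriod (substr (modify w k m) i j 1≤i j≤n) ℓ₂
lemma2p16 (suc d′) n _ _ w (suc q₀) _ 2ℓ₁<n (_ , _ , w-per) m m>0 m≤d-1
          (suc a) j (suc K) (s≤s z≤n) _ _ j≤n _ _ (s≤s a≤K) K<j ℓ₂ ℓ₂>0 ℓ₂≤ℓ₁ long side u-period =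
  [ (λ a+ℓ₁≤K → change-left (s≤s⁻¹ a+ℓ₁≤K) K<j) , change-right a≤K ] side
  where
  ℓ₁<n : suc q₀ < n
  ℓ₁<n = ≤-<-trans (m≤m+n (suc q₀) _) 2ℓ₁<n
  open PeriodicWord w (suc q₀) ℓ₁<n w-per
  letter-changed : modified K m K ≢ cls K
  letter-changed eq = addMod-changes (cls K) m m>0 (s≤s m≤d-1) (trans (sym (update-at cls K _)) eq)
  room : a + (suc q₀ + ℓ₂) ≤ j
  room = ≤-trans (+-monoʳ-≤ a long) (≤-reflexive (m+[n∸m]≡n (≤-trans a≤K (<⇒≤ K<j))))
  open OneLetterChange (suc q₀) cls cls-residue (modified K m) K (λ y → update-off cls K _ y)
    letter-changed a j ℓ₂ ℓ₂>0 ℓ₂≤ℓ₁ room (window-period K m a j j≤n ℓ₂ u-period)
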